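{- Writing $\nabla\Phi:=\,!?\Phi$ for i-formulas $\Phi$, the following principles are derivable in QHC: (1) $\cdot\,\alpha\to\nabla\alpha$; (2) $\cdot\,\nabla\nabla\alpha\to\nabla\alpha$; (3) $\cdot\,\nabla(\alpha\to\beta)\to(\nabla\alpha\to\nabla\beta)$; (4) $\cdot\,\nabla\curlywedge\to\curlywedge$.
   Context: Meta-logical framework. Formulas of a first-order language may contain individual variables and predicate variables. Meta-formulas are built from formulas using meta-conjunction $\&$, meta-implication $\Rightarrow$, and universal meta-quantifiers over individual and predicate variables. A principle $\cdot G$, for a formula $G$, is the meta-formula obtained by universally meta-quantifying all free individual variables of $G$ and then all predicate variables of $G$. A rule $F_1,\dots,F_m/G$ is the meta-formula $\forall^2(\forall^1F_1\,\&\cdots\&\,\forall^1F_m\Rightarrow\forall^1G)$, where $\forall^1$ meta-quantifies the free individual variables of the formula it precedes and $\forall^2$ meta-quantifies all predicate variables occurring. A logic $L$ is given by a derivation system $\mathcal D$, a meta-conjunction of finitely many principles and rules. For a meta-formula $\mathcal F$, $\vdash_L\mathcal F$ means that $\mathcal D\Rightarrow\mathcal F$ is derivable by the natural-deduction meta-rules: introduction and elimination of $\&$, $\Rightarrow$ and the universal meta-quantifiers (elimination allows substituting terms for individual variables and formulas for predicate variables), plus $\alpha$-conversion. Language of QHC. It has individual variables and, for each $n\ge0$, countably many $n$-ary problem variables $\alpha,\beta,\gamma,\delta,\theta,\dots$ and countably many $n$-ary proper predicate variables $p,q,\dots$. - A c-formula is $\top$, $\bot$, an atom $p(x_1,\dots,x_n)$,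 or $?\Phi$ for an i-formula $\Phi$, closed under the classical connectives $\land,\lor,\to,\leftrightarrow,\neg$ and quantifiers $\exists,\forall$. - An i-formula is $\checkmark$ (triviality), $\curlywedge$ (absurdity), an atom $\alpha(x_1,\dots,x_n)$, or $!F$ for a c-formula $F$, closed under the intuitionistic connectives $\land,\lor,\to,\leftrightarrow,\neg$ (with $\neg\Phi:=\Phi\to\curlywedge$) and quantifiers $\exists,\forall$. Connectives applied to c-formulas are classical; those applied to i-formulas are intuitionistic. QHC is the logic whose derivation system consists of: - (0a) all laws and rules of classical predicate logic QC, for c-formulas; - (0b) all laws and rules of intuitionistic predicate logic QH, for i-formulas; - the principles $\cdot\,?(\gamma\land\delta)\leftrightarrow ?\gamma\land ?\delta$, $\cdot\,?(\gamma\lor\delta)\leftrightarrow ?\gamma\lor ?\delta$, $\cdot\,?(\gamma\to\delta)\to(?\gamma\to ?\delta)$, $\cdot\,\neg ?\curlywedge$, $\cdot\,?\exists x\,\theta(x)\leftrightarrow\exists x\,?\theta(x)$, $\cdot\,?\forall x\,\theta(x)\to\forall x\,?\theta(x)$, $\cdot\,\gamma\to\,!?\gamma$, $\cdot\,\neg !\bot$, $\cdot\,?!p\to p$, $\cdot\,!p\to\,!?!p$ and $\cdot\,!(p\to q)\to(!p\to !q)$; - the rules $!p/p$ and $p/!p$. -}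

module Defs where

open import Data.Nat using (ℕ; zero; suc)
open import Data.Vec using (Vec; map)
open import Data.Product using (_×_)

-- Individual variables are de Bruijn indices (ℕ); the language has no
-- function symbols, so terms are just variables.

infixr 6 _∧c_ _∧i_
infixr 5 _∨c_ _∨i_
infixr 4 _⇒c_ _⇒i_
infix 3 _⇔c_ _⇔i_
infix 1 ⊢c_ ⊢i_
infix 9 ¿_ !_
infix 8 ¬c_ ¬i_

mutual
  data CF : Set where
    ⊤c   : CF
    ⊥c   : CF
    patm : (n k : ℕ) → Vec ℕ n → CF     -- proper predicate variable p_k of arity n applied to variables
    ¿_   : IF → CF
    _∧c_ : CF → CF → CF
    _∨c_ : CF → CF → CF
    _⇒c_ : CF → CF → CF
    ∃c   : CF → CF
    ∀c   : CF → CF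

  data IF : Set where
    ✓i   : IF
    ⋏i   : IF
    αatm : (n k : ℕ) → Vec ℕ n → IF     -- problem variable α_k of arity n applied to variables
    !_   : CF → IF
    _∧i_ : IF → IF → IF
    _∨i_ : IF → IF → IF
    _⇒i_ : IF → IF → IF
    ∃i   : IF → IF
    ∀i   : IF → IF

¬c_ : CF → CF
¬c A = A ⇒c ⊥c

_⇔c_ : CF → CF → CF
A ⇔c B = (A ⇒c B) ∧c (B ⇒c A)

¬i_ : IF → IF
¬i Φ = Φ ⇒i ⋏i

_⇔i_ : IF → IF → IF
Φ ⇔i Ψ = (Φ ⇒i Ψ) ∧i (Ψ ⇒i Φ)

∇ : IF → IF
∇ Φ = ! (¿ Φ)

ext : (ℕ → ℕ) → ℕ → ℕ
ext σ zero    = zero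
ext σ (suc i) = suc (σ i)

mutual
  renC : (ℕ → ℕ) → CF → CF
  renC σ ⊤c = ⊤c
  renC σ ⊥c = ⊥c
  renC σ (patm n k xs) = patm n k (map σ xs)
  renC σ (¿ Φ) = ¿ renI σ Φ
  renC σ (A ∧c B) = renC σ A ∧c renC σ B
  renC σ (A ∨c B) = renC σ A ∨c renC σ B
  renC σ (A ⇒c B) = renC σ A ⇒c renC σ B
  renC σ (∃c A) = ∃c (renC (ext σ) A)
  renC σ (∀c A) = ∀c (renC (ext σ) A)

  renI : (ℕ → ℕ) → IF → IF
  renI σ ✓i = ✓i
  renI σ ⋏i = ⋏i
  renI σ (αatm n k xs) = αatm n k (map σ xs)
  renI σ (! A) = ! renC σ A
  renI σ (Φ ∧i Ψ) = renI σ Φ ∧i renI σ Ψ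
  renI σ (Φ ∨i Ψ) = renI σ Φ ∨i renI σ Ψ
  renI σ (Φ ⇒i Ψ) = renI σ Φ ⇒i renI σ Ψ
  renI σ (∃i Φ) = ∃i (renI (ext σ) Φ)
  renI σ (∀i Φ) = ∀i (renI (ext σ) Φ)

-- substitution of variable y for the bound index 0 (body of a quantifier)
inst : ℕ → ℕ → ℕ
inst y zero    = y
inst y (suc i) = i

-- Derivability in QHC (Hilbert-style presentation; axiom schemes range over
-- all formulas, i.e. all substitution instances of the principles).
mutual
  data ⊢c_ : CF → Set where
    c-K    : ∀ {A B} → ⊢c A ⇒c (B ⇒c A)
    c-S    : ∀ {A B C} → ⊢c (A ⇒c B ⇒c C) ⇒c (A ⇒c B) ⇒c (A ⇒c C)
    c-∧I   : ∀ {A B} → ⊢c A ⇒c B ⇒c (A ∧c B)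
    c-∧E₁  : ∀ {A B} → ⊢c (A ∧c B) ⇒c A
    c-∧E₂  : ∀ {A B} → ⊢c (A ∧c B) ⇒c B
    c-∨I₁  : ∀ {A B} → ⊢c A ⇒c (A ∨c B)
    c-∨I₂  : ∀ {A B} → ⊢c B ⇒c (A ∨c B)
    c-∨E   : ∀ {A B C} → ⊢c (A ⇒c C) ⇒c (B ⇒c C) ⇒c (A ∨c B ⇒c C)
    c-⊥E   : ∀ {A} → ⊢c ⊥c ⇒c A
    c-⊤I   : ⊢c ⊤c
    c-DN   : ∀ {A} → ⊢c ¬c ¬c A ⇒c A
    c-∀E   : ∀ {A} y → ⊢c ∀c A ⇒c renC (inst y) A
    c-∃I   : ∀ {A} y → ⊢c renC (inst y) A ⇒c ∃c A
    c-MP   : ∀ {A B} → ⊢c A ⇒c B → ⊢c A → ⊢c B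
    c-∀I   : ∀ {A B} → ⊢c renC suc B ⇒c A → ⊢c B ⇒c ∀c A
    c-∃E   : ∀ {A B} → ⊢c A ⇒c renC suc B → ⊢c ∃c A ⇒c B
    ax-?∧  : ∀ {Φ Ψ} → ⊢c ¿ (Φ ∧i Ψ) ⇔c (¿ Φ ∧c ¿ Ψ)
    ax-?∨  : ∀ {Φ Ψ} → ⊢c ¿ (Φ ∨i Ψ) ⇔c (¿ Φ ∨c ¿ Ψ)
    ax-?⇒  : ∀ {Φ Ψ} → ⊢c ¿ (Φ ⇒i Ψ) ⇒c (¿ Φ ⇒c ¿ Ψ)
    ax-¬?⋏ : ⊢c ¬c (¿ ⋏i)
    ax-?∃  : ∀ {Φ} → ⊢c ¿ (∃i Φ) ⇔c ∃c (¿ Φ)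
    ax-?∀  : ∀ {Φ} → ⊢c ¿ (∀i Φ) ⇒c ∀c (¿ Φ)
    ax-?!  : ∀ {A} → ⊢c ¿ (! A) ⇒c A
    r-!elim : ∀ {A} → ⊢i ! A → ⊢c A

  data ⊢i_ : IF → Set where
    i-K    : ∀ {A B} → ⊢i A ⇒i (B ⇒i A)
    i-S    : ∀ {A B C} → ⊢i (A ⇒i B ⇒i C) ⇒i (A ⇒i B) ⇒i (A ⇒i C)
    i-∧I   : ∀ {A B} → ⊢i A ⇒i B ⇒i (A ∧i B)
    i-∧E₁  : ∀ {A B} → ⊢i (A ∧i B) ⇒i A
    i-∧E₂  : ∀ {A B} → ⊢i (A ∧i B) ⇒i B
    i-∨I₁  : ∀ {A B} → ⊢i A ⇒i (A ∨i B)
    i-∨I₂  : ∀ {A B} → ⊢i B ⇒i (A ∨i B)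
    i-∨E   : ∀ {A B C} → ⊢i (A ⇒i C) ⇒i (B ⇒i C) ⇒i (A ∨i B ⇒i C)
    i-⋏E   : ∀ {A} → ⊢i ⋏i ⇒i A
    i-✓I   : ⊢i ✓i
    i-∀E   : ∀ {A} y → ⊢i ∀i A ⇒i renI (inst y) A
    i-∃I   : ∀ {A} y → ⊢i renI (inst y) A ⇒i ∃i A
    i-MP   : ∀ {A B} → ⊢i A ⇒i B → ⊢i A → ⊢i B
    i-∀I   : ∀ {A B} → ⊢i renI suc B ⇒i A → ⊢i B ⇒i ∀i A
    i-∃E   : ∀ {A B} → ⊢i A ⇒i renI suc B → ⊢i ∃i A ⇒i B
    ax-γ!?  : ∀ {Φ} → ⊢i Φ ⇒i ! (¿ Φ)
    ax-¬!⊥  : ⊢i ¬i (! ⊥c)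
    ax-!!?! : ∀ {A} → ⊢i ! A ⇒i ! (¿ (! A))
    ax-!K   : ∀ {A B} → ⊢i ! (A ⇒c B) ⇒i (! A ⇒i ! B)
    r-!intro : ∀ {A} → ⊢c A → ⊢i ! A

{-# OPTIONS --safe #-}
module Submission where

open import Defs
open import Data.Nat using (ℕ)
open import Data.Vec using (Vec)
open import Data.Product using (_×_; _,_)

⇒i-trans : ∀ {Φ Ψ Θ} → ⊢i Φ ⇒i Ψ → ⊢i Ψ ⇒i Θ → ⊢i Φ ⇒i Θ
⇒i-trans φψ ψθ = i-MP (i-MP i-S (i-MP i-K ψθ)) φψ

!-map : ∀ {A B} → ⊢c A ⇒c B → ⊢i ! A ⇒i ! B
!-map ab = i-MP ax-!K (r-!intro ab)

∇-unit : ∀ {Φ} → ⊢i Φ ⇒i ∇ Φ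
∇-unit = ax-γ!?

∇-join : ∀ {Φ} → ⊢i ∇ (∇ Φ) ⇒i ∇ Φ
∇-join = !-map ax-?!

∇-K : ∀ {Φ Ψ} → ⊢i ∇ (Φ ⇒i Ψ) ⇒i (∇ Φ ⇒i ∇ Ψ)
∇-K = ⇒i-trans (!-map ax-?⇒) ax-!K

∇-⋏ : ⊢i ∇ ⋏i ⇒i ⋏i
∇-⋏ = ⇒i-trans (!-map ax-¬?⋏) ax-¬!⊥

mainTheorem10 :
    (∀ (n k : ℕ) (xs : Vec ℕ n) →
        ⊢i (αatm n k xs ⇒i ∇ (αatm n k xs)))
    × (∀ (n k : ℕ) (xs : Vec ℕ n) →
        ⊢i (∇ (∇ (αatm n k xs)) ⇒i ∇ (αatm n k xs)))
    × (∀ (n k m l : ℕ) (xs : Vec ℕ n) (ys : Vec ℕ m) →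
        ⊢i (∇ (αatm n k xs ⇒i αatm m l ys) ⇒i (∇ (αatm n k xs) ⇒i ∇ (αatm m l ys))))
    × (⊢i (∇ ⋏i ⇒i ⋏i))
mainTheorem10 =
    (λ _ _ _ → ∇-unit)
  , (λ _ _ _ → ∇-join)
  , (λ _ _ _ _ _ _ → ∇-K)
  , ∇-⋏
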